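{- Let $m\ge 1$ be an integer and let $\{a_n\}_{n\ge 1}$ be an arbitrary sequence of complex numbers. Then, as formal power series in $q$, \[ \sum_{n\ge 1}\frac{a_n q^n}{1-q^n}=(q^m;q)_\infty\sum_{n\ge 1}\left(\sum_{i=1}^{m-1}\sum_{j=1}^{\lfloor n/i\rfloor}p_{m-1}(n-ij)\,a_i+\sum_{k=m}^{n}s^{(m-1)}_{n,k}\,a_k\right)q^n . \]
   Context: $(x;q)_\infty=\prod_{j\ge 0}(1-xq^j)$, so $(q^m;q)_\infty=\prod_{j\ge m}(1-q^j)$. For an integer $t\ge 0$, $p_t(N)$ denotes the number of partitions of $N$ having none of $1,2,\dots,t$ as a part (so $p_0(N)=p(N)$ is Euler's partition function, $p_t(0)=1$, and $p_t(N)=0$ for $N<0$), and $s^{(t)}_{n,k}$ denotes the total number of parts equal to $k$, counted over all partitions of $n$ having none of $1,2,\dots,t$ as a part. For $m=1$ the sum over $i$ is empty. -}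

module Defs where

open import Level using (Level)
open import Algebra.Bundles using (CommutativeRing)
open import Data.Nat using (ℕ; zero; suc; _∸_; _≤ᵇ_; _<ᵇ_; _≡ᵇ_)
import Data.Nat as N
open import Data.Nat.DivMod using (_/_)
open import Data.Bool using (Bool; true; false; if_then_else_)
open import Data.List using (List; []; _∷_; [_]; map; concatMap; filterᵇ; length; upTo; foldr)
open import Data.Nat.ListAction using (sum)

range : ℕ → ℕ → List ℕ
range lo hi = map (lo N.+_) (upTo (suc hi ∸ lo))

-- gen fuel b n : all partitions of n into parts ≤ b, each written as a
-- non-increasing list of positive parts.  The fuel only guarantees
-- termination; fuel ≥ n suffices.
gen : ℕ → ℕ → ℕ → List (List ℕ)
gen _ b zero = [ [] ]
gen zero b (suc n) = []
gen (suc f) b (suc n) =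
  concatMap (λ k → map (k ∷_) (gen f k (suc n ∸ k)))
            (filterᵇ (λ k → k ≤ᵇ b) (range 1 (suc n)))

partitions : ℕ → List (List ℕ)
partitions n = gen n n n

allᵇ : (ℕ → Bool) → List ℕ → Bool
allᵇ P [] = true
allᵇ P (x ∷ xs) = if P x then allᵇ P xs else false

partitionsAbove : ℕ → ℕ → List (List ℕ)
partitionsAbove t n = filterᵇ (allᵇ (λ x → t <ᵇ x)) (partitions n)

p : ℕ → ℕ → ℕ
p t N = length (partitionsAbove t N)

countParts : ℕ → List ℕ → ℕ
countParts k xs = length (filterᵇ (λ x → x ≡ᵇ k) xs)

s : ℕ → ℕ → ℕ → ℕ
s t n k = sum (map (countParts k) (partitionsAbove t n))

-- ⌊ n / i ⌋ (only used with i ≥ 1; value 0 for i = 0 is irrelevant)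
divFloor : ℕ → ℕ → ℕ
divFloor n zero = 0
divFloor n (suc i) = n / suc i

module _ {c ℓ : Level} (R : CommutativeRing c ℓ) where
  open CommutativeRing R

  PS : Set c
  PS = ℕ → Carrier

  fromℕ : ℕ → Carrier
  fromℕ zero = 0#
  fromℕ (suc n) = 1# + fromℕ n

  Σ : List ℕ → (ℕ → Carrier) → Carrier
  Σ xs f = foldr (λ x acc → f x + acc) 0# xs

  _⊛_ : PS → PS → PS
  (f ⊛ g) n = Σ (range 0 n) (λ i → f i * g (n ∸ i))

  onePS : PS
  onePS zero = 1#
  onePS (suc n) = 0#

  oneMinusQ^ : ℕ → PS
  oneMinusQ^ j n =
    (if n ≡ᵇ 0 then 1# else 0#) + (if n ≡ᵇ j then - 1# else 0#)

  prodRange : ℕ → ℕ → PS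
  prodRange lo hi = foldr (λ j acc → oneMinusQ^ j ⊛ acc) onePS (range lo hi)

  -- (q^m; q)_∞ = ∏_{j ≥ m} (1 - q^j), for m ≥ 1.  Its coefficient of q^N
  -- equals that of the finite product over m ≤ j ≤ m + N, since the
  -- factors with j > N do not affect coefficients of degree ≤ N.
  qPochInf : ℕ → PS
  qPochInf m N = prodRange m (m N.+ N) N

  -- Σ_{n ≥ 1} a_n q^n / (1 - q^n) = Σ_{n ≥ 1} Σ_{k ≥ 1} a_n q^{nk};
  -- coefficient of q^N collects all n, k ≥ 1 with n * k = N.
  lambertLHS : (ℕ → Carrier) → PS
  lambertLHS a N =
    Σ (range 1 N) (λ n → Σ (range 1 N) (λ k →
      if (n N.* k) ≡ᵇ N then a n else 0#))

  rhsInner : ℕ → (ℕ → Carrier) → PS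
  rhsInner m a zero = 0#
  rhsInner m a (suc n') =
    Σ (range 1 (m ∸ 1)) (λ i →
        Σ (range 1 (divFloor n i)) (λ j →
          fromℕ (p (m ∸ 1) (n ∸ i N.* j)) * a i))
    + Σ (range m n) (λ k → fromℕ (s (m ∸ 1) n k) * a k)
    where n = suc n'

-- Write m = t + 1.  Multiplying by 1 - q^j is the operator f ↦ f - q^j f, which is the identity
-- below degree j, so up to degree N the product (q^m; q)_∞ may be replaced by the finite product
-- over m ≤ j ≤ B = m + N.  Both sides are linear in a, so it suffices that this finite product
-- sends the series multiplying a_k on the right to q^k / (1 - q^k).  For k ≥ m that series
-- counts the parts equal to k in partitions with parts in (t, B], i.e. it is q^k / (1 - q^k)
-- divided by (1 - q^m) ⋯ (1 - q^B); for k < m it is q^k / (1 - q^k) times Σ p_t(n) q^n, which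
-- agrees with 1 / ((1 - q^m) ⋯ (1 - q^B)) up to degree B.  Each of these identities is checked
-- after multiplying by 1 - q^k, which can be cancelled, via the recurrences obtained by raising
-- the largest allowed part one step at a time.

module Submission where

open import Level using (Level; _⊔_)
open import Algebra.Bundles using (CommutativeRing; CommutativeMonoid)
open import Data.Bool using (Bool; true; false; if_then_else_)
open import Data.List using (List; []; _∷_; [_]; _++_; map; foldr; filterᵇ; concatMap; applyUpTo; upTo; length)
open import Data.List.Properties using (map-upTo; map-++; map-cong; filter-++; foldr-++; upTo-∷ʳ)
import Data.Nat as ℕ
open ℕ using (ℕ; zero; suc; _∸_; _≤_; _<_; z≤n; s≤s; z<s; _≤′_; ≤′-refl; ≤′-step;
              _≤ᵇ_; _<ᵇ_; _≡ᵇ_; _≤?_; _<?_; _≟_)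
import Data.Nat.Properties as ℕₚ
open ℕₚ using
  (≤-refl; ≤-trans; ≤-reflexive; <⇒≤; ≤⇒≯; >⇒≢; <⇒≢; ≤∧≢⇒<; m<m+n; ≤-pred; ≤-<-trans; m∸n≤m;
   ≤ᵇ-reflects-≤; <ᵇ-reflects-<; <-≤-trans; <⇒≱; [m+n]∸[m+o]≡n∸o; m+[n∸m]≡n; m+n∸m≡n; m≤m*n; m≤m+n;
   m≤n+m; m≤n+m∸n; m≤n⇒m≤1+n; n∸n≡0; n≤1+n; n≮n; ≤′⇒≤; ≤⇒≤′; ≰⇒>)
open import Data.Nat.ListAction using (sum)
open import Data.Nat.ListAction.Properties using (sum-++)
open import Function using (_∘_)
open import Relation.Binary.PropositionalEquality as ≡ using (_≡_; _≢_)
open import Relation.Nullary.Decidable using (T?; dec-true; dec-false; does-⇔)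
open import Relation.Nullary using (yes; no; does; contradiction)
open import Relation.Nullary.Reflects using (ofʸ; ofⁿ)
open import Data.Nat.Induction using (<-rec)
open import Data.Nat.DivMod using (_/_; m<n⇒m/n≡0; m/n≡1+[m∸n]/n)
open import Data.Nat.Divisibility using (_∣?_; divides; ∣⇒≤; ∣-refl; ∣m+n∣m⇒∣n; ∣m∣n⇒∣m+n)
open import Function.Bundles using (mk⇔)
open import Defs

module IntervalSum {c ℓ : Level} (M : CommutativeMonoid c ℓ) where
  open import Data.Nat using (_+_)
  open CommutativeMonoid M renaming (Carrier to A)
  open import Algebra.Properties.CommutativeSemigroup commutativeSemigroup using (interchange)
  open import Relation.Binary.Reasoning.Setoid setoid

  sumFrom : ℕ → ℕ → (ℕ → A) → A
  sumFrom lo zero    f = ε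
  sumFrom lo (suc n) f = f lo ∙ sumFrom (suc lo) n f

  foldr-applyUpTo : ∀ f (g : ℕ → ℕ) lo n → (∀ i → g i ≡ lo + i) →
                    foldr (λ x acc → f x ∙ acc) ε (applyUpTo g n) ≡ sumFrom lo n f
  foldr-applyUpTo f g lo zero    g≗lo+ = ≡.refl
  foldr-applyUpTo f g lo (suc n) g≗lo+ =
    ≡.cong₂ _∙_ (≡.cong f (≡.trans (g≗lo+ 0) (ℕₚ.+-identityʳ lo)))
                (foldr-applyUpTo f (g ∘ suc) (suc lo) n (λ i → ≡.trans (g≗lo+ (suc i)) (ℕₚ.+-suc lo i)))

  foldr-range : ∀ f lo hi → foldr (λ x acc → f x ∙ acc) ε (range lo hi) ≡ sumFrom lo (suc hi ∸ lo) f
  foldr-range f lo hi = ≡.trans (≡.cong (foldr _ ε) (map-upTo (lo +_) (suc hi ∸ lo)))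
                                (foldr-applyUpTo f (lo +_) lo (suc hi ∸ lo) (λ _ → ≡.refl))

  private
    <-tail : ∀ {j} lo n → j < suc lo + n → j < lo + suc n
    <-tail {j} lo n = ≡.subst (j <_) (≡.sym (ℕₚ.+-suc lo n))

  sumFrom-cong : ∀ lo n {f g} → (∀ j → lo ≤ j → j < lo + n → f j ≈ g j) →
                 sumFrom lo n f ≈ sumFrom lo n g
  sumFrom-cong lo zero    f≈g = refl
  sumFrom-cong lo (suc n) f≈g =
    ∙-cong (f≈g lo ≤-refl (m<m+n lo z<s))
           (sumFrom-cong (suc lo) n (λ j lo<j j< → f≈g j (<⇒≤ lo<j) (<-tail lo n j<)))

  sumFrom-zero : ∀ lo n {f} → (∀ j → lo ≤ j → j < lo + n → f j ≈ ε) → sumFrom lo n f ≈ ε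
  sumFrom-zero lo zero    f≈ε = refl
  sumFrom-zero lo (suc n) {f} f≈ε = begin
    f lo ∙ sumFrom (suc lo) n f
      ≈⟨ ∙-cong (f≈ε lo ≤-refl (m<m+n lo z<s))
                (sumFrom-zero (suc lo) n (λ j lo<j j< → f≈ε j (<⇒≤ lo<j) (<-tail lo n j<))) ⟩
    ε ∙ ε
      ≈⟨ identityˡ ε ⟩
    ε
      ∎

  sumFrom-∙ : ∀ lo n f g → sumFrom lo n (λ j → f j ∙ g j) ≈ sumFrom lo n f ∙ sumFrom lo n g
  sumFrom-∙ lo zero    f g = sym (identityˡ ε)
  sumFrom-∙ lo (suc n) f g =
    trans (∙-cong refl (sumFrom-∙ (suc lo) n f g)) (interchange (f lo) (g lo) _ _)

  sumFrom-hom : ∀ (h : A → A) → (∀ {x y} → x ≈ y → h x ≈ h y) → h ε ≈ ε →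
                (∀ x y → h (x ∙ y) ≈ h x ∙ h y) →
                ∀ lo n f → h (sumFrom lo n f) ≈ sumFrom lo n (h ∘ f)
  sumFrom-hom h h-cong h-ε h-∙ lo zero    f = h-ε
  sumFrom-hom h h-cong h-ε h-∙ lo (suc n) f =
    trans (h-∙ (f lo) _) (∙-cong refl (sumFrom-hom h h-cong h-ε h-∙ (suc lo) n f))

  sumFrom-suc : ∀ lo n f → sumFrom (suc lo) n f ≡ sumFrom lo n (f ∘ suc)
  sumFrom-suc lo zero    f = ≡.refl
  sumFrom-suc lo (suc n) f = ≡.cong (f (suc lo) ∙_) (sumFrom-suc (suc lo) n f)

  sumFrom-+ : ∀ lo n₁ n₂ f → sumFrom lo (n₁ + n₂) f ≈ sumFrom lo n₁ f ∙ sumFrom (lo + n₁) n₂ f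
  sumFrom-+ lo zero     n₂ f =
    trans (reflexive (≡.cong (λ l → sumFrom l n₂ f) (≡.sym (ℕₚ.+-identityʳ lo)))) (sym (identityˡ _))
  sumFrom-+ lo (suc n₁) n₂ f = begin
    f lo ∙ sumFrom (suc lo) (n₁ + n₂) f
      ≈⟨ ∙-cong refl (sumFrom-+ (suc lo) n₁ n₂ f) ⟩
    f lo ∙ (sumFrom (suc lo) n₁ f ∙ sumFrom (suc lo + n₁) n₂ f)
      ≈⟨ assoc _ _ _ ⟨
    (f lo ∙ sumFrom (suc lo) n₁ f) ∙ sumFrom (suc lo + n₁) n₂ f
      ≡⟨ ≡.cong (λ l → (f lo ∙ sumFrom (suc lo) n₁ f) ∙ sumFrom l n₂ f) (≡.sym (ℕₚ.+-suc lo n₁)) ⟩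
    (f lo ∙ sumFrom (suc lo) n₁ f) ∙ sumFrom (lo + suc n₁) n₂ f
      ∎

  sumFrom-pad : ∀ lo n₁ n₂ f → n₁ ≤ n₂ → (∀ j → lo + n₁ ≤ j → f j ≈ ε) →
                sumFrom lo n₁ f ≈ sumFrom lo n₂ f
  sumFrom-pad lo zero     n₂       f _         f≈ε =
    sym (sumFrom-zero lo n₂ (λ j lo≤j _ → f≈ε j (≡.subst (_≤ j) (≡.sym (ℕₚ.+-identityʳ lo)) lo≤j)))
  sumFrom-pad lo (suc n₁) (suc n₂) f (s≤s n₁≤n₂) f≈ε =
    ∙-cong refl (sumFrom-pad (suc lo) n₁ n₂ f n₁≤n₂
                  (λ j le → f≈ε j (≡.subst (_≤ j) (≡.sym (ℕₚ.+-suc lo n₁)) le)))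

  sumFrom-unique : ∀ lo n c {f} → lo ≤ c → c < lo + n → (∀ j → j ≢ c → f j ≈ ε) →
                   sumFrom lo n f ≈ f c
  sumFrom-unique lo zero    c lo≤c c<lo+0 _ =
    contradiction (≤-trans c<lo+0 (≤-reflexive (ℕₚ.+-identityʳ lo))) (≤⇒≯ lo≤c)
  sumFrom-unique lo (suc n) c {f} lo≤c c< f≈ε with lo ≟ c
  ... | yes ≡.refl = begin
    f lo ∙ sumFrom (suc lo) n f ≈⟨ ∙-cong refl (sumFrom-zero (suc lo) n (λ j lo<j _ → f≈ε j (>⇒≢ lo<j))) ⟩
    f lo ∙ ε                    ≈⟨ identityʳ (f lo) ⟩
    f lo                        ∎
  ... | no lo≢c = begin
    f lo ∙ sumFrom (suc lo) n f
      ≈⟨ ∙-cong (f≈ε lo lo≢c)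
                (sumFrom-unique (suc lo) n c (≤∧≢⇒< lo≤c lo≢c) (≡.subst (c <_) (ℕₚ.+-suc lo n) c<) f≈ε) ⟩
    ε ∙ f c
      ≈⟨ identityˡ (f c) ⟩
    f c
      ∎

  sumFrom-pick : ∀ lo n c (x : ℕ → A) → lo ≤ c →
                 sumFrom lo n (λ j → if j ≡ᵇ c then x j else ε) ≈ (if c <ᵇ lo + n then x c else ε)
  sumFrom-pick lo n c x lo≤c with c <ᵇ lo + n | <ᵇ-reflects-< c (lo + n)
  ... | true  | ofʸ c<lo+n = begin
    sumFrom lo n (λ j → if j ≡ᵇ c then x j else ε)
      ≈⟨ sumFrom-unique lo n c lo≤c c<lo+n off-c ⟩
    (if c ≡ᵇ c then x c else ε)
      ≡⟨ ≡.cong (λ b → if b then x c else ε) (dec-true (c ≟ c) ≡.refl) ⟩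
    x c
      ∎
    where
    off-c : ∀ j → j ≢ c → (if j ≡ᵇ c then x j else ε) ≈ ε
    off-c j j≢c = reflexive (≡.cong (λ b → if b then x j else ε) (dec-false (j ≟ c) j≢c))
  ... | false | ofⁿ c≮lo+n = sumFrom-zero lo n (λ j _ j<lo+n →
    reflexive (≡.cong (λ b → if b then x j else ε) (dec-false (j ≟ c) (λ { ≡.refl → c≮lo+n j<lo+n }))))

module PartitionsAbove (t : ℕ) where
  open import Data.Nat using (_+_)
  open ≡ using (refl; sym; trans; cong; cong₂)
  open ≡.≡-Reasoning
  open import Algebra.Properties.CommutativeSemigroup ℕₚ.+-commutativeSemigroup using (interchange)
  open IntervalSum ℕₚ.+-0-commutativeMonoid
    using (sumFrom; foldr-range; sumFrom-cong; sumFrom-zero; sumFrom-∙; sumFrom-pick)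

  above? : List ℕ → Bool
  above? = allᵇ (t <ᵇ_)

  weigh : (List ℕ → ℕ) → List (List ℕ) → ℕ
  weigh w ps = sum (map w (filterᵇ above? ps))

  weigh-++ : ∀ w xs ys → weigh w (xs ++ ys) ≡ weigh w xs + weigh w ys
  weigh-++ w xs ys = begin
    sum (map w (filterᵇ above? (xs ++ ys)))
      ≡⟨ cong (sum ∘ map w) (filter-++ (T? ∘ above?) xs ys) ⟩
    sum (map w (filterᵇ above? xs ++ filterᵇ above? ys))
      ≡⟨ cong sum (map-++ w (filterᵇ above? xs) _) ⟩
    sum (map w (filterᵇ above? xs) ++ map w (filterᵇ above? ys))
      ≡⟨ sum-++ (map w (filterᵇ above? xs)) _ ⟩
    weigh w xs + weigh w ys
      ∎

  weigh-cong : ∀ {v w} → (∀ ps → v ps ≡ w ps) → ∀ xs → weigh v xs ≡ weigh w xs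
  weigh-cong v≗w xs = cong sum (map-cong v≗w (filterᵇ above? xs))

  weigh-+ : ∀ v w xs → weigh (λ ps → v ps + w ps) xs ≡ weigh v xs + weigh w xs
  weigh-+ v w xs = sum-map-+ (filterᵇ above? xs)
    where
    sum-map-+ : ∀ qss → sum (map (λ ps → v ps + w ps) qss) ≡ sum (map v qss) + sum (map w qss)
    sum-map-+ []         = refl
    sum-map-+ (qs ∷ qss) = trans (cong (v qs + w qs +_) (sum-map-+ qss)) (interchange (v qs) (w qs) _ _)

  weigh-map-∷ : ∀ w k pss → weigh w (map (k ∷_) pss) ≡ (if t <ᵇ k then weigh (λ ps → w (k ∷ ps)) pss else 0)
  weigh-map-∷ w k []         with t <ᵇ k
  ... | true  = refl
  ... | false = refl
  weigh-map-∷ w k (ps ∷ pss) with t <ᵇ k | weigh-map-∷ w k pss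
  ... | false | ih = ih
  ... | true  | ih with above? ps
  ...   | true  = cong (w (k ∷ ps) +_) ih
  ...   | false = ih

  weigh-concatMap : ∀ w (G : ℕ → List (List ℕ)) (Q : ℕ → Bool) xs →
    weigh w (concatMap G (filterᵇ Q xs)) ≡ foldr (λ x acc → (if Q x then weigh w (G x) else 0) + acc) 0 xs
  weigh-concatMap w G Q []       = refl
  weigh-concatMap w G Q (x ∷ xs) with Q x
  ... | true  = trans (weigh-++ w (G x) _) (cong (weigh w (G x) +_) (weigh-concatMap w G Q xs))
  ... | false = weigh-concatMap w G Q xs

  branch : (List ℕ → ℕ) → ℕ → ℕ → ℕ → ℕ
  branch w f n j = if t <ᵇ j then weigh (λ ps → w (j ∷ ps)) (gen f j (n ∸ j)) else 0

  weigh-gen : ∀ w f b n →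
    weigh w (gen (suc f) b (suc n)) ≡ sumFrom 1 (suc n) (λ j → if j ≤ᵇ b then branch w f (suc n) j else 0)
  weigh-gen w f b n = begin
    weigh w (gen (suc f) b (suc n))
      ≡⟨ weigh-concatMap w _ (_≤ᵇ b) (range 1 (suc n)) ⟩
    foldr (λ j acc → (if j ≤ᵇ b then weigh w (map (j ∷_) (gen f j (suc n ∸ j))) else 0) + acc) 0 (range 1 (suc n))
      ≡⟨ foldr-range _ 1 (suc n) ⟩
    sumFrom 1 (suc n) (λ j → if j ≤ᵇ b then weigh w (map (j ∷_) (gen f j (suc n ∸ j))) else 0)
      ≡⟨ sumFrom-cong 1 (suc n) (λ j _ _ →
           cong (λ x → if j ≤ᵇ b then x else 0) (weigh-map-∷ w j (gen f j (suc n ∸ j)))) ⟩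
    sumFrom 1 (suc n) (λ j → if j ≤ᵇ b then branch w f (suc n) j else 0)
      ∎

  weigh-gen-fuel : ∀ w f g b n → n ≤ f → n ≤ g → weigh w (gen f b n) ≡ weigh w (gen g b n)
  weigh-gen-fuel w f       g       b zero    _         _         = refl
  weigh-gen-fuel w (suc f) (suc g) b (suc n) (s≤s n≤f) (s≤s n≤g) = begin
    weigh w (gen (suc f) b (suc n))
      ≡⟨ weigh-gen w f b n ⟩
    sumFrom 1 (suc n) (λ j → if j ≤ᵇ b then branch w f (suc n) j else 0)
      ≡⟨ sumFrom-cong 1 (suc n) (λ j 1≤j _ → cong (λ x → if j ≤ᵇ b then x else 0) (branch-fuel j 1≤j)) ⟩
    sumFrom 1 (suc n) (λ j → if j ≤ᵇ b then branch w g (suc n) j else 0)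
      ≡⟨ weigh-gen w g b n ⟨
    weigh w (gen (suc g) b (suc n))
      ∎
    where
    branch-fuel : ∀ j → 1 ≤ j → branch w f (suc n) j ≡ branch w g (suc n) j
    branch-fuel (suc j) _ = cong (λ x → if t <ᵇ suc j then x else 0)
      (weigh-gen-fuel _ f g (suc j) (n ∸ j) (≤-trans (m∸n≤m n j) n≤f) (≤-trans (m∸n≤m n j) n≤g))

  count : (List ℕ → ℕ) → ℕ → ℕ → ℕ
  count w b n = weigh w (gen n b n)

  count-cong : ∀ {v w} → (∀ ps → v ps ≡ w ps) → ∀ b n → count v b n ≡ count w b n
  count-cong v≗w b n = weigh-cong v≗w (gen n b n)

  count-+ : ∀ v w b n → count (λ ps → v ps + w ps) b n ≡ count v b n + count w b n
  count-+ v w b n = weigh-+ v w (gen n b n)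

  count-bound-irrelevant : ∀ w {b b′} n → n ≤ b → n ≤ b′ → count w b n ≡ count w b′ n
  count-bound-irrelevant w zero    _   _    = refl
  count-bound-irrelevant w {b} {b′} (suc n) 1+n≤b 1+n≤b′ = begin
    weigh w (gen (suc n) b (suc n))
      ≡⟨ weigh-gen w n b n ⟩
    sumFrom 1 (suc n) (λ j → if j ≤ᵇ b then branch w n (suc n) j else 0)
      ≡⟨ sumFrom-cong 1 (suc n) (λ j _ j≤1+n → trans (drop-guard 1+n≤b j≤1+n) (sym (drop-guard 1+n≤b′ j≤1+n))) ⟩
    sumFrom 1 (suc n) (λ j → if j ≤ᵇ b′ then branch w n (suc n) j else 0)
      ≡⟨ weigh-gen w n b′ n ⟨
    weigh w (gen (suc n) b′ (suc n))
      ∎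
    where
    drop-guard : ∀ {c j} → suc n ≤ c → j < suc (suc n) →
                 (if j ≤ᵇ c then branch w n (suc n) j else 0) ≡ branch w n (suc n) j
    drop-guard {c} {j} 1+n≤c j≤1+n rewrite dec-true (j ≤? c) (≤-trans (≤-pred j≤1+n) 1+n≤c) = refl

  count-suc-bound : ∀ w {b} n → t ≤ b →
    count w (suc b) n ≡ count w b n + (if suc b ≤ᵇ n then count (λ ps → w (suc b ∷ ps)) (suc b) (n ∸ suc b) else 0)
  count-suc-bound w zero    _   = sym (ℕₚ.+-identityʳ _)
  count-suc-bound w {b} (suc n) t≤b = begin
    weigh w (gen (suc n) (suc b) (suc n))
      ≡⟨ weigh-gen w n (suc b) n ⟩
    sumFrom 1 (suc n) (λ j → if j ≤ᵇ suc b then B j else 0)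
      ≡⟨ sumFrom-cong 1 (suc n) (λ { (suc j) _ _ → if-<ᵇ-suc j b (B (suc j)) }) ⟩
    sumFrom 1 (suc n) (λ j → (if j ≤ᵇ b then B j else 0) + (if j ≡ᵇ suc b then B j else 0))
      ≡⟨ sumFrom-∙ 1 (suc n) (λ j → if j ≤ᵇ b then B j else 0) (λ j → if j ≡ᵇ suc b then B j else 0) ⟩
    sumFrom 1 (suc n) (λ j → if j ≤ᵇ b then B j else 0) + sumFrom 1 (suc n) (λ j → if j ≡ᵇ suc b then B j else 0)
      ≡⟨ cong₂ _+_ (sym (weigh-gen w n b n)) (sumFrom-pick 1 (suc n) (suc b) B (s≤s z≤n)) ⟩
    count w b (suc n) + (if b <ᵇ suc n then B (suc b) else 0)
      ≡⟨ cong (λ x → count w b (suc n) + (if b <ᵇ suc n then x else 0)) largest-part-1+b ⟩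
    count w b (suc n) + (if b <ᵇ suc n then count (λ ps → w (suc b ∷ ps)) (suc b) (n ∸ b) else 0)
      ∎
    where
    B : ℕ → ℕ
    B = branch w n (suc n)
    if-<ᵇ-suc : ∀ j b x → (if j <ᵇ suc b then x else 0) ≡ (if j <ᵇ b then x else 0) + (if j ≡ᵇ b then x else 0)
    if-<ᵇ-suc zero    zero    x = refl
    if-<ᵇ-suc zero    (suc b) x = sym (ℕₚ.+-identityʳ x)
    if-<ᵇ-suc (suc j) zero    x = refl
    if-<ᵇ-suc (suc j) (suc b) x = if-<ᵇ-suc j b x
    largest-part-1+b : B (suc b) ≡ count (λ ps → w (suc b ∷ ps)) (suc b) (n ∸ b)
    largest-part-1+b rewrite dec-true (t <? suc b) (s≤s t≤b) =
      weigh-gen-fuel _ n (n ∸ b) (suc b) (n ∸ b) (m∸n≤m n b) ≤-refl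

  count-trivial-bound : ∀ w {b} n → b ≤ t → count w b (suc n) ≡ 0
  count-trivial-bound w {b} n b≤t = trans (weigh-gen w n b n) (sumFrom-zero 1 (suc n) no-branch)
    where
    no-branch : ∀ j → 1 ≤ j → j < 1 + suc n → (if j ≤ᵇ b then branch w n (suc n) j else 0) ≡ 0
    no-branch j _ _ with j ≤ᵇ b | ≤ᵇ-reflects-≤ j b
    ... | false | _        = refl
    ... | true  | ofʸ j≤b rewrite dec-false (t <? j) (≤⇒≯ (≤-trans j≤b b≤t)) = refl

  partitionCount : ℕ → ℕ → ℕ
  partitionCount = count (λ _ → 1)

  partCount : ℕ → ℕ → ℕ → ℕ
  partCount k = count (countParts k)

  p≡partitionCount : ∀ n → p t n ≡ partitionCount n n
  p≡partitionCount n = length≡sum-map-1 (filterᵇ above? (gen n n n))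
    where
    length≡sum-map-1 : ∀ (pss : List (List ℕ)) → length pss ≡ sum (map (λ _ → 1) pss)
    length≡sum-map-1 []         = refl
    length≡sum-map-1 (_ ∷ pss) = cong suc (length≡sum-map-1 pss)

  countParts-∷-≢ : ∀ {j k} ps → j ≢ k → countParts k (j ∷ ps) ≡ countParts k ps
  countParts-∷-≢ {j} {k} ps j≢k rewrite dec-false (j ≟ k) j≢k = refl

  countParts-∷-≡ : ∀ k ps → countParts k (k ∷ ps) ≡ suc (countParts k ps)
  countParts-∷-≡ k ps rewrite dec-true (k ≟ k) refl = refl

  partCount-suc-bound-≢ : ∀ {k b} n → t ≤ b → suc b ≢ k →
    partCount k (suc b) n ≡ partCount k b n + (if suc b ≤ᵇ n then partCount k (suc b) (n ∸ suc b) else 0)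
  partCount-suc-bound-≢ {k} {b} n t≤b 1+b≢k =
    trans (count-suc-bound (countParts k) n t≤b)
          (cong (λ x → partCount k b n + (if suc b ≤ᵇ n then x else 0))
                (count-cong (λ ps → countParts-∷-≢ ps 1+b≢k) (suc b) (n ∸ suc b)))

  partCount-suc-bound-≡ : ∀ {b} n → t ≤ b →
    partCount (suc b) (suc b) n ≡ partCount (suc b) b n +
      (if suc b ≤ᵇ n then partitionCount (suc b) (n ∸ suc b) + partCount (suc b) (suc b) (n ∸ suc b) else 0)
  partCount-suc-bound-≡ {b} n t≤b =
    trans (count-suc-bound (countParts (suc b)) n t≤b)
          (cong (λ x → partCount (suc b) b n + (if suc b ≤ᵇ n then x else 0))
                (trans (count-cong (countParts-∷-≡ (suc b)) (suc b) (n ∸ suc b))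
                       (count-+ (λ _ → 1) (countParts (suc b)) (suc b) (n ∸ suc b))))

  partCount-small-bound : ∀ {k b} n → b < k → partCount k b n ≡ 0
  partCount-small-bound {k} {b} n = vanish n b n
    where
    vanish : ∀ f b n → b < k → weigh (countParts k) (gen f b n) ≡ 0
    vanish f       b zero    _   = refl
    vanish zero    b (suc n) _   = refl
    vanish (suc f) b (suc n) b<k = trans (weigh-gen (countParts k) f b n) (sumFrom-zero 1 (suc n) no-part-k)
      where
      if-0 : ∀ c {x} → x ≡ 0 → (if c then x else 0) ≡ 0
      if-0 true  x≡0 = x≡0
      if-0 false _   = refl
      no-part-k : ∀ j → 1 ≤ j → j < 1 + suc n → (if j ≤ᵇ b then branch (countParts k) f (suc n) j else 0) ≡ 0
      no-part-k j _ _ with j ≤ᵇ b | ≤ᵇ-reflects-≤ j b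
      ... | false | _       = refl
      ... | true  | ofʸ j≤b = if-0 (t <ᵇ j)
        (trans (weigh-cong (λ ps → countParts-∷-≢ ps (<⇒≢ (≤-<-trans j≤b b<k))) (gen f j (suc n ∸ j)))
               (vanish f j (suc n ∸ j) (≤-<-trans j≤b b<k)))

range-suc : ∀ lo hi → lo ≤ suc hi → range lo (suc hi) ≡ range lo hi ++ [ suc hi ]
range-suc lo hi lo≤1+hi = begin
  map (lo +_) (upTo (suc (suc hi) ∸ lo))                ≡⟨ ≡.cong (map (lo +_) ∘ upTo) (ℕₚ.+-∸-assoc 1 lo≤1+hi) ⟩
  map (lo +_) (upTo (suc (suc hi ∸ lo)))                ≡⟨ ≡.cong (map (lo +_)) (upTo-∷ʳ (suc hi ∸ lo)) ⟨
  map (lo +_) (upTo (suc hi ∸ lo) ++ [ suc hi ∸ lo ])   ≡⟨ map-++ (lo +_) (upTo (suc hi ∸ lo)) _ ⟩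
  range lo hi ++ [ lo + (suc hi ∸ lo) ]                 ≡⟨ ≡.cong (λ x → range lo hi ++ [ x ]) (m+[n∸m]≡n lo≤1+hi) ⟩
  range lo hi ++ [ suc hi ]                             ∎
  where
  open ≡.≡-Reasoning
  open import Data.Nat using (_+_)

range-empty : ∀ t → range (suc t) t ≡ []
range-empty t = ≡.cong (map (suc t ℕ.+_) ∘ upTo) (n∸n≡0 t)

module PowerSeries {c ℓ : Level} (R : CommutativeRing c ℓ) where
  open CommutativeRing R renaming (Carrier to A)
  open import Algebra.Properties.Ring ring using (-‿distribʳ-*; [y-z]x≈yx-zx; -1*x≈-x)
  open import Algebra.Properties.AbelianGroup +-abelianGroup using (⁻¹-∙-comm)
  open import Algebra.Properties.Group +-group using (ε⁻¹≈ε)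
  open import Algebra.Properties.CommutativeSemigroup +-commutativeSemigroup using (interchange)
  open import Relation.Binary.Reasoning.Setoid setoid
  open IntervalSum +-commutativeMonoid

  x+y-y≈x : ∀ x y → x + y - y ≈ x
  x+y-y≈x x y = trans (+-assoc x y (- y)) (trans (+-cong refl (-‿inverseʳ y)) (+-identityʳ x))

  x-y+y≈x : ∀ x y → x - y + y ≈ x
  x-y+y≈x x y = trans (+-assoc x (- y) y) (trans (+-cong refl (-‿inverseˡ y)) (+-identityʳ x))

  x-0≈x : ∀ x → x - 0# ≈ x
  x-0≈x x = trans (+-cong refl ε⁻¹≈ε) (+-identityʳ x)

  x*-1≈-x : ∀ x → x * - 1# ≈ - x
  x*-1≈-x x = trans (sym (-‿distribʳ-* x 1#)) (-‿cong (*-identityʳ x))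

  [x+y]-[z+w]≈[x-z]+[y-w] : ∀ x y z w → (x + y) - (z + w) ≈ (x - z) + (y - w)
  [x+y]-[z+w]≈[x-z]+[y-w] x y z w =
    trans (+-cong refl (sym (⁻¹-∙-comm z w))) (interchange x y (- z) (- w))

  infix  4 _≐_ _≐[≤_]_
  infixl 6 _⊕_ _⊖_
  infixl 7 _·_

  _≐_ : PS R → PS R → Set ℓ
  f ≐ g = ∀ n → f n ≈ g n

  _≐[≤_]_ : PS R → ℕ → PS R → Set ℓ
  f ≐[≤ M ] g = ∀ n → n ≤ M → f n ≈ g n

  _⊕_ : PS R → PS R → PS R
  (f ⊕ g) n = f n + g n

  _⊖_ : PS R → PS R → PS R
  (f ⊖ g) n = f n - g n

  _·_ : PS R → A → PS R
  (f · a) n = f n * a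

  𝟘 : PS R
  𝟘 _ = 0#

  shift : ℕ → PS R → PS R
  shift zero    f n       = f n
  shift (suc j) f zero    = 0#
  shift (suc j) f (suc n) = shift j f n

  mulOneMinusQ^ : ℕ → PS R → PS R
  mulOneMinusQ^ j f = f ⊖ shift j f

  mulProd : List ℕ → PS R → PS R
  mulProd js f = foldr mulOneMinusQ^ f js

  shift-below : ∀ j f {n} → n < j → shift j f n ≡ 0#
  shift-below (suc j) f {zero}  _         = ≡.refl
  shift-below (suc j) f {suc n} (s≤s n<j) = shift-below j f n<j

  shift-+ : ∀ j f r → shift j f (j ℕ.+ r) ≡ f r
  shift-+ zero    f r = ≡.refl
  shift-+ (suc j) f r = shift-+ j f r

  shift-if : ∀ j f n → shift j f n ≡ (if j ≤ᵇ n then f (n ∸ j) else 0#)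
  shift-if zero    f n       = ≡.refl
  shift-if (suc j) f zero    = ≡.refl
  shift-if (suc j) f (suc n) = ≡.trans (shift-if j f n) (≡.cong (λ b → if b then f (n ∸ j) else 0#) (≤ᵇ-suc j))
    where
    ≤ᵇ-suc : ∀ j → (j ≤ᵇ n) ≡ (j <ᵇ suc n)
    ≤ᵇ-suc zero    = ≡.refl
    ≤ᵇ-suc (suc j) = ≡.refl

  shift-shift : ∀ i j f n → shift i (shift j f) n ≡ shift j (shift i f) n
  shift-shift i j f n = ≡.trans (shift-shift-+ i j f n)
                          (≡.trans (≡.cong (λ k → shift k f n) (ℕₚ.+-comm i j)) (≡.sym (shift-shift-+ j i f n)))
    where
    shift-shift-+ : ∀ i j f n → shift i (shift j f) n ≡ shift (i ℕ.+ j) f n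
    shift-shift-+ zero    j f n       = ≡.refl
    shift-shift-+ (suc i) j f zero    = ≡.refl
    shift-shift-+ (suc i) j f (suc n) = shift-shift-+ i j f n

  shift-cong≤ : ∀ j M {f g} → f ≐[≤ M ] g → shift j f ≐[≤ j ℕ.+ M ] shift j g
  shift-cong≤ zero    M f≐g n       n≤M       = f≐g n n≤M
  shift-cong≤ (suc j) M f≐g zero    _         = refl
  shift-cong≤ (suc j) M f≐g (suc n) (s≤s n≤M) = shift-cong≤ j M f≐g n n≤M

  record IsCausalLinear (L : PS R → PS R) : Set (c ⊔ ℓ) where
    field
      cong≤ : ∀ M {f g} → f ≐[≤ M ] g → L f ≐[≤ M ] L g
      ⊕-hom : ∀ f g → L (f ⊕ g) ≐ L f ⊕ L g
      ·-hom : ∀ f a → L (f · a) ≐ L f · a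

    cong : ∀ {f g} → f ≐ g → L f ≐ L g
    cong f≐g n = cong≤ n (λ m _ → f≐g m) n ≤-refl

    𝟘-hom : L 𝟘 ≐ 𝟘
    𝟘-hom n = begin
      L 𝟘 n         ≈⟨ cong (λ _ → sym (zeroʳ 0#)) n ⟩
      L (𝟘 · 0#) n  ≈⟨ ·-hom 𝟘 0# n ⟩
      L 𝟘 n * 0#    ≈⟨ zeroʳ _ ⟩
      0#            ∎

    ⊖-hom : ∀ f g → L (f ⊖ g) ≐ L f ⊖ L g
    ⊖-hom f g n = begin
      L (f ⊖ g) n              ≈⟨ cong (λ m → +-cong refl (sym (x*-1≈-x (g m)))) n ⟩
      L (f ⊕ g · - 1#) n       ≈⟨ ⊕-hom f (g · - 1#) n ⟩
      L f n + L (g · - 1#) n   ≈⟨ +-cong refl (·-hom g (- 1#) n) ⟩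
      L f n + L g n * - 1#     ≈⟨ +-cong refl (x*-1≈-x (L g n)) ⟩
      L f n - L g n            ∎

    sum-hom : ∀ lo len (F : ℕ → PS R) →
                  L (λ n → sumFrom lo len (λ k → F k n)) ≐ (λ n → sumFrom lo len (λ k → L (F k) n))
    sum-hom lo zero      F = 𝟘-hom
    sum-hom lo (suc len) F n =
      trans (⊕-hom (F lo) _ n) (+-cong refl (sum-hom (suc lo) len F n))

  id-isCausalLinear : IsCausalLinear (λ f → f)
  id-isCausalLinear = record
    { cong≤ = λ M f≐g → f≐g
    ; ⊕-hom = λ f g n → refl
    ; ·-hom = λ f a n → refl
    }

  ∘-isCausalLinear : ∀ {L₁ L₂} → IsCausalLinear L₁ → IsCausalLinear L₂ → IsCausalLinear (L₁ ∘ L₂)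
  ∘-isCausalLinear {L₁} {L₂} lin₁ lin₂ = record
    { cong≤ = λ M f≐g → L₁.cong≤ M (L₂.cong≤ M f≐g)
    ; ⊕-hom = λ f g n → trans (L₁.cong (L₂.⊕-hom f g) n) (L₁.⊕-hom (L₂ f) (L₂ g) n)
    ; ·-hom = λ f a n → trans (L₁.cong (L₂.·-hom f a) n) (L₁.·-hom (L₂ f) a n)
    }
    where
    module L₁ = IsCausalLinear lin₁
    module L₂ = IsCausalLinear lin₂

  ⊖-isCausalLinear : ∀ {L₁ L₂} → IsCausalLinear L₁ → IsCausalLinear L₂ →
                     IsCausalLinear (λ f → L₁ f ⊖ L₂ f)
  ⊖-isCausalLinear {L₁} {L₂} lin₁ lin₂ = record
    { cong≤ = λ M f≐g n n≤M → +-cong (L₁.cong≤ M f≐g n n≤M) (-‿cong (L₂.cong≤ M f≐g n n≤M))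
    ; ⊕-hom = λ f g n → trans (+-cong (L₁.⊕-hom f g n) (-‿cong (L₂.⊕-hom f g n)))
                              ([x+y]-[z+w]≈[x-z]+[y-w] (L₁ f n) (L₁ g n) (L₂ f n) (L₂ g n))
    ; ·-hom = λ f a n → trans (+-cong (L₁.·-hom f a n) (-‿cong (L₂.·-hom f a n)))
                              (sym ([y-z]x≈yx-zx a (L₁ f n) (L₂ f n)))
    }
    where
    module L₁ = IsCausalLinear lin₁
    module L₂ = IsCausalLinear lin₂

  shift-isCausalLinear : ∀ j → IsCausalLinear (shift j)
  shift-isCausalLinear j = record
    { cong≤ = λ M f≐g n n≤M → shift-cong≤ j M f≐g n (≤-trans n≤M (m≤n+m M j))
    ; ⊕-hom = shift-⊕ j
    ; ·-hom = shift-· j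
    }
    where
    shift-⊕ : ∀ j f g → shift j (f ⊕ g) ≐ shift j f ⊕ shift j g
    shift-⊕ zero    f g n       = refl
    shift-⊕ (suc j) f g zero    = sym (+-identityʳ 0#)
    shift-⊕ (suc j) f g (suc n) = shift-⊕ j f g n
    shift-· : ∀ j f a → shift j (f · a) ≐ shift j f · a
    shift-· zero    f a n       = refl
    shift-· (suc j) f a zero    = sym (zeroˡ a)
    shift-· (suc j) f a (suc n) = shift-· j f a n

  mulOneMinusQ^-isCausalLinear : ∀ j → IsCausalLinear (mulOneMinusQ^ j)
  mulOneMinusQ^-isCausalLinear j = ⊖-isCausalLinear id-isCausalLinear (shift-isCausalLinear j)

  mulProd-isCausalLinear : ∀ js → IsCausalLinear (mulProd js)
  mulProd-isCausalLinear []       = id-isCausalLinear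
  mulProd-isCausalLinear (j ∷ js) = ∘-isCausalLinear (mulOneMinusQ^-isCausalLinear j) (mulProd-isCausalLinear js)

  module Shift         j  = IsCausalLinear (shift-isCausalLinear j)
  module MulOneMinusQ^ j  = IsCausalLinear (mulOneMinusQ^-isCausalLinear j)
  module MulProd       js = IsCausalLinear (mulProd-isCausalLinear js)

  mulOneMinusQ^-shift : ∀ i j f → mulOneMinusQ^ i (shift j f) ≐ shift j (mulOneMinusQ^ i f)
  mulOneMinusQ^-shift i j f n = begin
    shift j f n - shift i (shift j f) n ≡⟨ ≡.cong (λ x → shift j f n - x) (shift-shift i j f n) ⟩
    shift j f n - shift j (shift i f) n ≈⟨ Shift.⊖-hom j f (shift i f) n ⟨
    shift j (mulOneMinusQ^ i f) n       ∎

  mulProd-shift : ∀ js j f → mulProd js (shift j f) ≐ shift j (mulProd js f)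
  mulProd-shift []       j f n = refl
  mulProd-shift (i ∷ js) j f n =
    trans (MulOneMinusQ^.cong i (mulProd-shift js j f) n) (mulOneMinusQ^-shift i j (mulProd js f) n)

  mulProd-mulOneMinusQ^ : ∀ js k f → mulProd js (mulOneMinusQ^ k f) ≐ mulOneMinusQ^ k (mulProd js f)
  mulProd-mulOneMinusQ^ js k f n =
    trans (MulProd.⊖-hom js f (shift k f) n) (+-cong refl (-‿cong (mulProd-shift js k f n)))

  mulProd-range-suc : ∀ lo hi f → lo ≤ suc hi →
                      mulProd (range lo (suc hi)) f ≡ mulProd (range lo hi) (mulOneMinusQ^ (suc hi) f)
  mulProd-range-suc lo hi f lo≤1+hi =
    ≡.trans (≡.cong (λ js → mulProd js f) (range-suc lo hi lo≤1+hi)) (foldr-++ mulOneMinusQ^ f (range lo hi) [ suc hi ])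

  mulOneMinusQ^-low : ∀ j M f → M < j → mulOneMinusQ^ j f ≐[≤ M ] f
  mulOneMinusQ^-low j M f M<j n n≤M = begin
    f n - shift j f n ≡⟨ ≡.cong (λ x → f n - x) (shift-below j f (≤-<-trans n≤M M<j)) ⟩
    f n - 0#          ≈⟨ x-0≈x (f n) ⟩
    f n               ∎

  mulProd-range-stable : ∀ lo hi {b} f → lo ≤ suc hi → hi ≤′ b →
                         mulProd (range lo b) f ≐[≤ hi ] mulProd (range lo hi) f
  mulProd-range-stable lo hi f _       ≤′-refl              n n≤hi = refl
  mulProd-range-stable lo hi {suc b} f lo≤1+hi (≤′-step hi≤′b) n n≤hi = begin
    mulProd (range lo (suc b)) f n
      ≡⟨ ≡.cong (λ g → g n) (mulProd-range-suc lo b f (≤-trans lo≤1+hi (s≤s (≤′⇒≤ hi≤′b)))) ⟩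
    mulProd (range lo b) (mulOneMinusQ^ (suc b) f) n
      ≈⟨ MulProd.cong≤ (range lo b) hi (mulOneMinusQ^-low (suc b) hi f (s≤s (≤′⇒≤ hi≤′b))) n n≤hi ⟩
    mulProd (range lo b) f n
      ≈⟨ mulProd-range-stable lo hi f lo≤1+hi hi≤′b n n≤hi ⟩
    mulProd (range lo hi) f n
      ∎

  mulOneMinusQ^-cancel : ∀ k M {f g} → mulOneMinusQ^ (suc k) f ≐[≤ M ] mulOneMinusQ^ (suc k) g → f ≐[≤ M ] g
  mulOneMinusQ^-cancel k M {f} {g} Tf≐Tg = <-rec (λ n → n ≤ M → f n ≈ g n) step
    where
    step : ∀ n → (∀ {m} → m < n → m ≤ M → f m ≈ g m) → n ≤ M → f n ≈ g n
    step n f≐g-below n≤M = begin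
      f n
        ≈⟨ x-y+y≈x (f n) (shift (suc k) f n) ⟨
      mulOneMinusQ^ (suc k) f n + shift (suc k) f n
        ≈⟨ +-cong (Tf≐Tg n n≤M) (shifts-agree n (λ m<n → f≐g-below m<n (≤-trans (<⇒≤ m<n) n≤M))) ⟩
      mulOneMinusQ^ (suc k) g n + shift (suc k) g n
        ≈⟨ x-y+y≈x (g n) (shift (suc k) g n) ⟩
      g n
        ∎
      where
      shifts-agree : ∀ n → (∀ {m} → m < n → f m ≈ g m) → shift (suc k) f n ≈ shift (suc k) g n
      shifts-agree zero    _         = refl
      shifts-agree (suc n) f≐g-below = shift-cong≤ k n (λ m m≤n → f≐g-below (s≤s m≤n)) n (m≤n+m n k)

  fromℕ-+ : ∀ x y → fromℕ R (x ℕ.+ y) ≈ fromℕ R x + fromℕ R y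
  fromℕ-+ zero    y = sym (+-identityˡ _)
  fromℕ-+ (suc x) y = trans (+-cong refl (fromℕ-+ x y)) (sym (+-assoc 1# _ _))

  fromℕ-recurrence : ∀ j {x y z : ℕ → ℕ} → (∀ n → x n ≡ y n ℕ.+ (if j ≤ᵇ n then z (n ∸ j) else 0)) →
                     fromℕ R ∘ x ≐ (fromℕ R ∘ y) ⊕ shift j (fromℕ R ∘ z)
  fromℕ-recurrence j {x} {y} {z} x≡y+z n = begin
    fromℕ R (x n)
      ≡⟨ ≡.cong (fromℕ R) (x≡y+z n) ⟩
    fromℕ R (y n ℕ.+ (if j ≤ᵇ n then z (n ∸ j) else 0))
      ≈⟨ fromℕ-+ (y n) _ ⟩
    fromℕ R (y n) + fromℕ R (if j ≤ᵇ n then z (n ∸ j) else 0)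
      ≡⟨ ≡.cong (fromℕ R (y n) +_) (fromℕ-if (j ≤ᵇ n)) ⟩
    fromℕ R (y n) + (if j ≤ᵇ n then fromℕ R (z (n ∸ j)) else 0#)
      ≡⟨ ≡.cong (fromℕ R (y n) +_) (shift-if j (fromℕ R ∘ z) n) ⟨
    fromℕ R (y n) + shift j (fromℕ R ∘ z) n
      ∎
    where
    fromℕ-if : ∀ b → fromℕ R (if b then z (n ∸ j) else 0) ≡ (if b then fromℕ R (z (n ∸ j)) else 0#)
    fromℕ-if true  = ≡.refl
    fromℕ-if false = ≡.refl

  Σ-*ʳ : ∀ xs f a → Σ R xs (λ j → f j * a) ≈ Σ R xs f * a
  Σ-*ʳ []       f a = sym (zeroˡ a)
  Σ-*ʳ (x ∷ xs) f a = trans (+-cong refl (Σ-*ʳ xs f a)) (sym (distribʳ a (f x) (Σ R xs f)))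

  mulOneMinusQ^-recurrence : ∀ j {f g} → f ≐ g ⊕ shift j f → mulOneMinusQ^ j f ≐ g
  mulOneMinusQ^-recurrence j {f} {g} f≐g+shift n =
    trans (+-cong (f≐g+shift n) refl) (x+y-y≈x (g n) (shift j f n))

  mulOneMinusQ^-blocks : ∀ j {f g} → (∀ {n} → n < j → f n ≈ 0#) → (∀ r → f (j ℕ.+ r) ≈ g r + f r) →
                         mulOneMinusQ^ j f ≐ shift j g
  mulOneMinusQ^-blocks j {f} {g} f-low f-block n with j ≤? n
  ... | no j≰n = begin
    f n - shift j f n ≡⟨ ≡.cong (λ x → f n - x) (shift-below j f (≰⇒> j≰n)) ⟩
    f n - 0#          ≈⟨ x-0≈x (f n) ⟩
    f n               ≈⟨ f-low (≰⇒> j≰n) ⟩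
    0#                ≡⟨ shift-below j g (≰⇒> j≰n) ⟨
    shift j g n       ∎
  ... | yes j≤n = ≡.subst (λ n → mulOneMinusQ^ j f n ≈ shift j g n) (m+[n∸m]≡n j≤n) (block (n ∸ j))
    where
    block : ∀ r → mulOneMinusQ^ j f (j ℕ.+ r) ≈ shift j g (j ℕ.+ r)
    block r = begin
      f (j ℕ.+ r) - shift j f (j ℕ.+ r) ≡⟨ ≡.cong (λ x → f (j ℕ.+ r) - x) (shift-+ j f r) ⟩
      f (j ℕ.+ r) - f r                 ≈⟨ +-cong (f-block r) refl ⟩
      g r + f r - f r                   ≈⟨ x+y-y≈x (g r) (f r) ⟩
      g r                               ≡⟨ shift-+ j g r ⟨
      shift j g (j ℕ.+ r)               ∎

  ⊛-sumFrom : ∀ f g n → _⊛_ R f g n ≡ sumFrom 0 (suc n) (λ i → f i * g (n ∸ i))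
  ⊛-sumFrom f g n = foldr-range (λ i → f i * g (n ∸ i)) 0 n

  ⊛-congˡ≤ : ∀ M {f f′} g → f ≐[≤ M ] f′ → _⊛_ R f g ≐[≤ M ] _⊛_ R f′ g
  ⊛-congˡ≤ M {f} {f′} g f≐f′ n n≤M = begin
    _⊛_ R f g n                                  ≡⟨ ⊛-sumFrom f g n ⟩
    sumFrom 0 (suc n) (λ i → f i * g (n ∸ i))    ≈⟨ sumFrom-cong 0 (suc n) (λ i _ i≤n →
                                                      *-cong (f≐f′ i (≤-trans (≤-pred i≤n) n≤M)) refl) ⟩
    sumFrom 0 (suc n) (λ i → f′ i * g (n ∸ i))   ≡⟨ ⊛-sumFrom f′ g n ⟨
    _⊛_ R f′ g n                                 ∎

  ⊛-congˡ : ∀ {f f′} g → f ≐ f′ → _⊛_ R f g ≐ _⊛_ R f′ g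
  ⊛-congˡ g f≐f′ n = ⊛-congˡ≤ n g (λ m _ → f≐f′ m) n ≤-refl

  ⊛-distribʳ-⊕ : ∀ f f′ g → _⊛_ R (f ⊕ f′) g ≐ _⊛_ R f g ⊕ _⊛_ R f′ g
  ⊛-distribʳ-⊕ f f′ g n = begin
    _⊛_ R (f ⊕ f′) g n
      ≡⟨ ⊛-sumFrom (f ⊕ f′) g n ⟩
    sumFrom 0 (suc n) (λ i → (f i + f′ i) * g (n ∸ i))
      ≈⟨ sumFrom-cong 0 (suc n) (λ i _ _ → distribʳ (g (n ∸ i)) (f i) (f′ i)) ⟩
    sumFrom 0 (suc n) (λ i → f i * g (n ∸ i) + f′ i * g (n ∸ i))
      ≈⟨ sumFrom-∙ 0 (suc n) (λ i → f i * g (n ∸ i)) (λ i → f′ i * g (n ∸ i)) ⟩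
    sumFrom 0 (suc n) (λ i → f i * g (n ∸ i)) + sumFrom 0 (suc n) (λ i → f′ i * g (n ∸ i))
      ≡⟨ ≡.cong₂ _+_ (⊛-sumFrom f g n) (⊛-sumFrom f′ g n) ⟨
    _⊛_ R f g n + _⊛_ R f′ g n
      ∎

  ⊛-distribʳ-⊖ : ∀ f f′ g → _⊛_ R (f ⊖ f′) g ≐ _⊛_ R f g ⊖ _⊛_ R f′ g
  ⊛-distribʳ-⊖ f f′ g n = begin
    _⊛_ R (f ⊖ f′) g n
      ≡⟨ ⊛-sumFrom (f ⊖ f′) g n ⟩
    sumFrom 0 (suc n) (λ i → (f i - f′ i) * g (n ∸ i))
      ≈⟨ sumFrom-cong 0 (suc n) (λ i _ _ → [y-z]x≈yx-zx (g (n ∸ i)) (f i) (f′ i)) ⟩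
    sumFrom 0 (suc n) (λ i → f i * g (n ∸ i) - f′ i * g (n ∸ i))
      ≈⟨ sumFrom-∙ 0 (suc n) (λ i → f i * g (n ∸ i)) (λ i → - (f′ i * g (n ∸ i))) ⟩
    sumFrom 0 (suc n) (λ i → f i * g (n ∸ i)) + sumFrom 0 (suc n) (λ i → - (f′ i * g (n ∸ i)))
      ≈⟨ +-cong refl (sumFrom-hom -_ -‿cong ε⁻¹≈ε (λ x y → sym (⁻¹-∙-comm x y))
                                  0 (suc n) (λ i → f′ i * g (n ∸ i))) ⟨
    sumFrom 0 (suc n) (λ i → f i * g (n ∸ i)) - sumFrom 0 (suc n) (λ i → f′ i * g (n ∸ i))
      ≡⟨ ≡.cong₂ _-_ (⊛-sumFrom f g n) (⊛-sumFrom f′ g n) ⟨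
    _⊛_ R f g n - _⊛_ R f′ g n
      ∎

  monomial : ℕ → A → PS R
  monomial j x i = if i ≡ᵇ j then x else 0#

  monomial-⊛ : ∀ j x g → _⊛_ R (monomial j x) g ≐ (λ n → x * shift j g n)
  monomial-⊛ j x g n = ≡.subst (_≈ x * shift j g n) (≡.sym (⊛-sumFrom (monomial j x) g n)) (picks j n)
    where
    picks : ∀ j n → sumFrom 0 (suc n) (λ i → monomial j x i * g (n ∸ i)) ≈ x * shift j g n
    picks zero    n       = begin
      x * g n + sumFrom 1 n (λ i → monomial 0 x i * g (n ∸ i))
        ≈⟨ +-cong refl (sumFrom-zero 1 n (λ { (suc i) _ _ → zeroˡ _ })) ⟩
      x * g n + 0#
        ≈⟨ +-identityʳ _ ⟩
      x * g n
        ∎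
    picks (suc j) zero    = trans (+-identityʳ _) (trans (zeroˡ _) (sym (zeroʳ x)))
    picks (suc j) (suc n) = begin
      0# * g (suc n) + sumFrom 1 (suc n) (λ i → monomial (suc j) x i * g (suc n ∸ i))
        ≈⟨ +-cong (zeroˡ _) (reflexive (sumFrom-suc 0 (suc n) _)) ⟩
      0# + sumFrom 0 (suc n) (λ i → monomial j x i * g (n ∸ i))
        ≈⟨ +-identityˡ _ ⟩
      sumFrom 0 (suc n) (λ i → monomial j x i * g (n ∸ i))
        ≈⟨ picks j n ⟩
      x * shift j g n
        ∎

  shift-⊛ : ∀ j f g → _⊛_ R (shift j f) g ≐ shift j (_⊛_ R f g)
  shift-⊛ j f g n = ≡.subst (_≈ shift j (_⊛_ R f g) n) (≡.sym (⊛-sumFrom (shift j f) g n)) (shifted j n)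
    where
    shifted : ∀ j n → sumFrom 0 (suc n) (λ i → shift j f i * g (n ∸ i)) ≈ shift j (_⊛_ R f g) n
    shifted zero    n       = reflexive (≡.sym (⊛-sumFrom f g n))
    shifted (suc j) zero    = trans (+-identityʳ _) (zeroˡ _)
    shifted (suc j) (suc n) = begin
      0# * g (suc n) + sumFrom 1 (suc n) (λ i → shift (suc j) f i * g (suc n ∸ i))
        ≈⟨ +-cong (zeroˡ _) (reflexive (sumFrom-suc 0 (suc n) _)) ⟩
      0# + sumFrom 0 (suc n) (λ i → shift j f i * g (n ∸ i))
        ≈⟨ +-identityˡ _ ⟩
      sumFrom 0 (suc n) (λ i → shift j f i * g (n ∸ i))
        ≈⟨ shifted j n ⟩
      shift j (_⊛_ R f g) n
        ∎

  oneMinusQ^-⊛ : ∀ j g → _⊛_ R (oneMinusQ^ R j) g ≐ mulOneMinusQ^ j g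
  oneMinusQ^-⊛ j g n = begin
    -- oneMinusQ^ R j unfolds to monomial 0 1# ⊕ monomial j (- 1#)
    _⊛_ R (monomial 0 1# ⊕ monomial j (- 1#)) g n
      ≈⟨ ⊛-distribʳ-⊕ (monomial 0 1#) (monomial j (- 1#)) g n ⟩
    _⊛_ R (monomial 0 1#) g n + _⊛_ R (monomial j (- 1#)) g n
      ≈⟨ +-cong (monomial-⊛ 0 1# g n) (monomial-⊛ j (- 1#) g n) ⟩
    1# * g n + - 1# * shift j g n
      ≈⟨ +-cong (*-identityˡ (g n)) (-1*x≈-x (shift j g n)) ⟩
    g n - shift j g n
      ∎

  mulOneMinusQ^-⊛ : ∀ j f g → _⊛_ R (mulOneMinusQ^ j f) g ≐ mulOneMinusQ^ j (_⊛_ R f g)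
  mulOneMinusQ^-⊛ j f g n = trans (⊛-distribʳ-⊖ f (shift j f) g n) (+-cong refl (-‿cong (shift-⊛ j f g n)))

  onePS-⊛ : ∀ g → _⊛_ R (onePS R) g ≐ g
  onePS-⊛ g n = begin
    _⊛_ R (onePS R) g n       ≈⟨ ⊛-congˡ g (λ { zero → refl ; (suc i) → refl }) n ⟩
    _⊛_ R (monomial 0 1#) g n ≈⟨ monomial-⊛ 0 1# g n ⟩
    1# * g n                  ≈⟨ *-identityˡ (g n) ⟩
    g n                       ∎

  polyProd : List ℕ → PS R
  polyProd = foldr (λ j acc → _⊛_ R (oneMinusQ^ R j) acc) (onePS R)

  polyProd-⊛ : ∀ js g → _⊛_ R (polyProd js) g ≐ mulProd js g
  polyProd-⊛ []       g n = onePS-⊛ g n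
  polyProd-⊛ (j ∷ js) g n = begin
    _⊛_ R (_⊛_ R (oneMinusQ^ R j) (polyProd js)) g n ≈⟨ ⊛-congˡ g (oneMinusQ^-⊛ j (polyProd js)) n ⟩
    _⊛_ R (mulOneMinusQ^ j (polyProd js)) g n        ≈⟨ mulOneMinusQ^-⊛ j (polyProd js) g n ⟩
    mulOneMinusQ^ j (_⊛_ R (polyProd js) g) n        ≈⟨ MulOneMinusQ^.cong j (polyProd-⊛ js g) n ⟩
    mulOneMinusQ^ j (mulProd js g) n                 ∎

  polyProd≐mulProd : ∀ js → polyProd js ≐ mulProd js (onePS R)
  polyProd≐mulProd []       n = refl
  polyProd≐mulProd (j ∷ js) n =
    trans (oneMinusQ^-⊛ j (polyProd js) n) (MulOneMinusQ^.cong j (polyProd≐mulProd js) n)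

  qPochInf-truncation : ∀ m N → qPochInf R m ≐[≤ N ] polyProd (range m (m ℕ.+ N))
  qPochInf-truncation m N i i≤N = begin
    polyProd (range m (m ℕ.+ i)) i               ≈⟨ polyProd≐mulProd (range m (m ℕ.+ i)) i ⟩
    mulProd (range m (m ℕ.+ i)) (onePS R) i      ≈⟨ mulProd-range-stable m (m ℕ.+ i) (onePS R) (m≤n⇒m≤1+n (m≤m+n m i))
                                                     (≤⇒≤′ (ℕₚ.+-monoʳ-≤ m i≤N)) i (m≤n+m i m) ⟨
    mulProd (range m (m ℕ.+ N)) (onePS R) i      ≈⟨ polyProd≐mulProd (range m (m ℕ.+ N)) i ⟨
    polyProd (range m (m ℕ.+ N)) i               ∎

module PartitionSeries {c ℓ : Level} (R : CommutativeRing c ℓ) (t : ℕ) where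
  open CommutativeRing R renaming (Carrier to A)
  open PowerSeries R
  open PartitionsAbove t using (partitionCount; partCount; count-suc-bound; count-trivial-bound;
    count-bound-irrelevant; p≡partitionCount; partCount-suc-bound-≢; partCount-suc-bound-≡; partCount-small-bound)
  open IntervalSum +-commutativeMonoid
  open import Relation.Binary.Reasoning.Setoid setoid

  -- 1 / ((1 - q^(t+1)) ⋯ (1 - q^b))
  partitionsGF : ℕ → PS R
  partitionsGF b = fromℕ R ∘ partitionCount b

  -- q^k / (1 - q^k) · partitionsGF b, for t < k ≤ b
  partsGF : ℕ → ℕ → PS R
  partsGF k b = fromℕ R ∘ partCount k b

  pGF : PS R
  pGF n = fromℕ R (p t n)

  -- q^k / (1 - q^k)
  lambertGF : ℕ → PS R
  lambertGF k zero    = 0#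
  lambertGF k (suc n) = if does (k ∣? suc n) then 1# else 0#

  -- q^i / (1 - q^i) · pGF
  lambertPGF : ℕ → PS R
  lambertPGF i n = Σ R (range 1 (divFloor n i)) (λ j → pGF (n ∸ i ℕ.* j))

  mulOneMinusQ^-partitionsGF : ∀ {b} → t ≤ b → mulOneMinusQ^ (suc b) (partitionsGF (suc b)) ≐ partitionsGF b
  mulOneMinusQ^-partitionsGF {b} t≤b =
    mulOneMinusQ^-recurrence (suc b) (fromℕ-recurrence (suc b) {z = partitionCount (suc b)} (λ n → count-suc-bound _ n t≤b))

  partitionsGF-t : partitionsGF t ≐ onePS R
  partitionsGF-t zero    = +-identityʳ 1#
  partitionsGF-t (suc n) = reflexive (≡.cong (fromℕ R) (count-trivial-bound _ n ≤-refl))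

  mulProd-partitionsGF : ∀ {b} → t ≤′ b → mulProd (range (suc t) b) (partitionsGF b) ≐ onePS R
  mulProd-partitionsGF ≤′-refl n =
    trans (reflexive (≡.cong (λ js → mulProd js (partitionsGF t) n) (range-empty t))) (partitionsGF-t n)
  mulProd-partitionsGF {suc b} (≤′-step t≤′b) n = begin
    mulProd (range (suc t) (suc b)) (partitionsGF (suc b)) n
      ≡⟨ ≡.cong (λ g → g n) (mulProd-range-suc (suc t) b _ (s≤s (≤′⇒≤ t≤′b))) ⟩
    mulProd (range (suc t) b) (mulOneMinusQ^ (suc b) (partitionsGF (suc b))) n
      ≈⟨ MulProd.cong (range (suc t) b) (mulOneMinusQ^-partitionsGF (≤′⇒≤ t≤′b)) n ⟩
    mulProd (range (suc t) b) (partitionsGF b) n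
      ≈⟨ mulProd-partitionsGF t≤′b n ⟩
    onePS R n
      ∎

  mulProd-pGF : ∀ {b} → t ≤ b → mulProd (range (suc t) b) pGF ≐[≤ b ] onePS R
  mulProd-pGF {b} t≤b n n≤b =
    trans (MulProd.cong≤ (range (suc t) b) b pGF≐partitionsGF n n≤b) (mulProd-partitionsGF (≤⇒≤′ t≤b) n)
    where
    pGF≐partitionsGF : pGF ≐[≤ b ] partitionsGF b
    pGF≐partitionsGF n n≤b = reflexive (≡.cong (fromℕ R)
      (≡.trans (p≡partitionCount n) (count-bound-irrelevant _ n ≤-refl n≤b)))

  lambertGF-low : ∀ k {n} → n < k → lambertGF k n ≈ 0#
  lambertGF-low k {zero}  _   = refl
  lambertGF-low k {suc n} n<k =
    reflexive (≡.cong (λ b → if b then 1# else 0#) (dec-false (k ∣? suc n) (λ k∣n → <⇒≱ n<k (∣⇒≤ k∣n))))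

  mulOneMinusQ^-lambertGF : ∀ k → mulOneMinusQ^ (suc k) (lambertGF (suc k)) ≐ shift (suc k) (onePS R)
  mulOneMinusQ^-lambertGF k = mulOneMinusQ^-blocks (suc k) (lambertGF-low (suc k)) block
    where
    block : ∀ r → lambertGF (suc k) (suc k ℕ.+ r) ≈ onePS R r + lambertGF (suc k) r
    block zero    rewrite ℕₚ.+-identityʳ k | dec-true (suc k ∣? suc k) ∣-refl = sym (+-identityʳ 1#)
    block (suc r) = begin
      (if does (suc k ∣? suc k ℕ.+ suc r) then 1# else 0#)
        ≡⟨ ≡.cong (λ b → if b then 1# else 0#) (does-⇔ (mk⇔ (λ d → ∣m+n∣m⇒∣n d ∣-refl) (∣m∣n⇒∣m+n ∣-refl))
                                                        (suc k ∣? suc k ℕ.+ suc r) (suc k ∣? suc r)) ⟩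
      lambertGF (suc k) (suc r)
        ≈⟨ +-identityˡ _ ⟨
      0# + lambertGF (suc k) (suc r)
        ∎

  lambertPGF-low : ∀ i {n} → n < suc i → lambertPGF (suc i) n ≈ 0#
  lambertPGF-low i {n} n<1+i =
    reflexive (≡.cong (λ q → Σ R (range 1 q) (λ j → pGF (n ∸ suc i ℕ.* j))) (m<n⇒m/n≡0 n<1+i))

  lambertPGF-block : ∀ i r → lambertPGF (suc i) (suc i ℕ.+ r) ≈ pGF r + lambertPGF (suc i) r
  lambertPGF-block i r = begin
    Σ R (range 1 ((I ℕ.+ r) / I)) g
      ≡⟨ ≡.cong (λ q → Σ R (range 1 q) g) quotient-suc ⟩
    Σ R (range 1 (suc (r / I))) g
      ≡⟨ foldr-range g 1 (suc (r / I)) ⟩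
    g 1 + sumFrom 2 (r / I) g
      ≡⟨ ≡.cong₂ _+_ first-term (sumFrom-suc 1 (r / I) g) ⟩
    pGF r + sumFrom 1 (r / I) (g ∘ suc)
      ≈⟨ +-cong refl (sumFrom-cong 1 (r / I) (λ j _ _ → reflexive (later-term j))) ⟩
    pGF r + sumFrom 1 (r / I) (λ j → pGF (r ∸ I ℕ.* j))
      ≡⟨ ≡.cong (pGF r +_) (foldr-range _ 1 (r / I)) ⟨
    pGF r + lambertPGF I r
      ∎
    where
    I : ℕ
    I = suc i
    g : ℕ → A
    g j = pGF (I ℕ.+ r ∸ I ℕ.* j)
    quotient-suc : (I ℕ.+ r) / I ≡ suc (r / I)
    quotient-suc = ≡.trans (m/n≡1+[m∸n]/n (m≤m+n I r)) (≡.cong (λ x → suc (x / I)) (m+n∸m≡n I r))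
    first-term : g 1 ≡ pGF r
    first-term = ≡.cong pGF (≡.trans (≡.cong (I ℕ.+ r ∸_) (ℕₚ.*-identityʳ I)) (m+n∸m≡n I r))
    later-term : ∀ j → g (suc j) ≡ pGF (r ∸ I ℕ.* j)
    later-term j = ≡.cong pGF (≡.trans (≡.cong (I ℕ.+ r ∸_) (ℕₚ.*-suc I j)) ([m+n]∸[m+o]≡n∸o I r (I ℕ.* j)))

  mulOneMinusQ^-lambertPGF : ∀ i → mulOneMinusQ^ (suc i) (lambertPGF (suc i)) ≐ shift (suc i) pGF
  mulOneMinusQ^-lambertPGF i = mulOneMinusQ^-blocks (suc i) (lambertPGF-low i) (lambertPGF-block i)

  mulProd-lambertPGF : ∀ i {b} → t ≤ b →
                       mulProd (range (suc t) b) (lambertPGF (suc i)) ≐[≤ b ] lambertGF (suc i)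
  mulProd-lambertPGF i {b} t≤b = mulOneMinusQ^-cancel i b same-image
    where
    I : ℕ
    I = suc i
    js : List ℕ
    js = range (suc t) b
    same-image : mulOneMinusQ^ I (mulProd js (lambertPGF I)) ≐[≤ b ] mulOneMinusQ^ I (lambertGF I)
    same-image n n≤b = begin
      mulOneMinusQ^ I (mulProd js (lambertPGF I)) n
        ≈⟨ mulProd-mulOneMinusQ^ js I (lambertPGF I) n ⟨
      mulProd js (mulOneMinusQ^ I (lambertPGF I)) n
        ≈⟨ MulProd.cong js (mulOneMinusQ^-lambertPGF i) n ⟩
      mulProd js (shift I pGF) n
        ≈⟨ mulProd-shift js I pGF n ⟩
      shift I (mulProd js pGF) n
        ≈⟨ shift-cong≤ I b (mulProd-pGF t≤b) n (≤-trans n≤b (m≤n+m b I)) ⟩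
      shift I (onePS R) n
        ≈⟨ mulOneMinusQ^-lambertGF i n ⟨
      mulOneMinusQ^ I (lambertGF I) n
        ∎

  partsGF-low : ∀ {k b} → b < k → partsGF k b ≐ 𝟘
  partsGF-low b<k n = reflexive (≡.cong (fromℕ R) (partCount-small-bound n b<k))

  mulOneMinusQ^-partsGF-≢ : ∀ {k b} → t ≤ b → suc b ≢ k →
                            mulOneMinusQ^ (suc b) (partsGF k (suc b)) ≐ partsGF k b
  mulOneMinusQ^-partsGF-≢ {k} {b} t≤b 1+b≢k = mulOneMinusQ^-recurrence (suc b)
    (fromℕ-recurrence (suc b) {z = partCount k (suc b)} (λ n → partCount-suc-bound-≢ n t≤b 1+b≢k))

  mulOneMinusQ^-partsGF-≡ : ∀ {b} → t ≤ b →
    mulOneMinusQ^ (suc b) (partsGF (suc b) (suc b)) ≐ shift (suc b) (partitionsGF (suc b))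
  mulOneMinusQ^-partsGF-≡ {b} t≤b = mulOneMinusQ^-recurrence (suc b) recurrence
    where
    K : ℕ
    K = suc b
    recurrence : partsGF K K ≐ shift K (partitionsGF K) ⊕ shift K (partsGF K K)
    recurrence n = begin
      partsGF K K n
        ≈⟨ fromℕ-recurrence K {z = λ r → partitionCount K r ℕ.+ partCount K K r}
                             (λ n → partCount-suc-bound-≡ n t≤b) n ⟩
      partsGF K b n + shift K (λ r → fromℕ R (partitionCount K r ℕ.+ partCount K K r)) n
        ≈⟨ +-cong (partsGF-low ≤-refl n) (Shift.cong K (λ r → fromℕ-+ (partitionCount K r) _) n) ⟩
      0# + shift K (partitionsGF K ⊕ partsGF K K) n
        ≈⟨ +-identityˡ _ ⟩
      shift K (partitionsGF K ⊕ partsGF K K) n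
        ≈⟨ Shift.⊕-hom K (partitionsGF K) (partsGF K K) n ⟩
      shift K (partitionsGF K) n + shift K (partsGF K K) n
        ∎

  mulProd-partsGF-peel : ∀ {k b} → t < k → k ≤′ b →
                         mulProd (range (suc t) b) (partsGF k b) ≐ mulProd (range (suc t) k) (partsGF k k)
  mulProd-partsGF-peel t<k ≤′-refl n = refl
  mulProd-partsGF-peel {k} {suc b} t<k (≤′-step k≤′b) n = begin
    mulProd (range (suc t) (suc b)) (partsGF k (suc b)) n
      ≡⟨ ≡.cong (λ g → g n) (mulProd-range-suc (suc t) b _ (m≤n⇒m≤1+n (≤-trans t<k k≤b))) ⟩
    mulProd (range (suc t) b) (mulOneMinusQ^ (suc b) (partsGF k (suc b))) n
      ≈⟨ MulProd.cong (range (suc t) b)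
           (mulOneMinusQ^-partsGF-≢ (<⇒≤ (<-≤-trans t<k k≤b)) (λ { ≡.refl → n≮n b k≤b })) n ⟩
    mulProd (range (suc t) b) (partsGF k b) n
      ≈⟨ mulProd-partsGF-peel t<k k≤′b n ⟩
    mulProd (range (suc t) k) (partsGF k k) n
      ∎
    where
    k≤b : k ≤ b
    k≤b = ≤′⇒≤ k≤′b

  mulProd-partsGF : ∀ {k b} → t < k → k ≤ b → mulProd (range (suc t) b) (partsGF k b) ≐ lambertGF k
  mulProd-partsGF {suc k} {b} (s≤s t≤k) k≤b n = begin
    mulProd (range (suc t) b) (partsGF K b) n ≈⟨ mulProd-partsGF-peel (s≤s t≤k) (≤⇒≤′ k≤b) n ⟩
    mulProd (range (suc t) K) (partsGF K K) n ≈⟨ mulOneMinusQ^-cancel k n (λ m _ → same-image m) n ≤-refl ⟩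
    lambertGF K n                             ∎
    where
    K : ℕ
    K = suc k
    js : List ℕ
    js = range (suc t) k
    same-image : mulOneMinusQ^ K (mulProd (range (suc t) K) (partsGF K K)) ≐ mulOneMinusQ^ K (lambertGF K)
    same-image n = begin
      mulOneMinusQ^ K (mulProd (range (suc t) K) (partsGF K K)) n
        ≡⟨ ≡.cong (λ g → mulOneMinusQ^ K g n) (mulProd-range-suc (suc t) k (partsGF K K) (s≤s t≤k)) ⟩
      mulOneMinusQ^ K (mulProd js (mulOneMinusQ^ K (partsGF K K))) n
        ≈⟨ MulOneMinusQ^.cong K (MulProd.cong js (mulOneMinusQ^-partsGF-≡ t≤k)) n ⟩
      mulOneMinusQ^ K (mulProd js (shift K (partitionsGF K))) n
        ≈⟨ MulOneMinusQ^.cong K (mulProd-shift js K (partitionsGF K)) n ⟩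
      mulOneMinusQ^ K (shift K (mulProd js (partitionsGF K))) n
        ≈⟨ mulOneMinusQ^-shift K K (mulProd js (partitionsGF K)) n ⟩
      shift K (mulOneMinusQ^ K (mulProd js (partitionsGF K))) n
        ≈⟨ Shift.cong K (mulProd-mulOneMinusQ^ js K (partitionsGF K)) n ⟨
      shift K (mulProd js (mulOneMinusQ^ K (partitionsGF K))) n
        ≈⟨ Shift.cong K (MulProd.cong js (mulOneMinusQ^-partitionsGF t≤k)) n ⟩
      shift K (mulProd js (partitionsGF k)) n
        ≈⟨ Shift.cong K (mulProd-partitionsGF (≤⇒≤′ t≤k)) n ⟩
      shift K (onePS R) n
        ≈⟨ mulOneMinusQ^-lambertGF k n ⟨
      mulOneMinusQ^ K (lambertGF K) n
        ∎

  divisor-indicator-sum : ∀ (a : ℕ → A) k .{{_ : ℕ.NonZero k}} N →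
    Σ R (range 1 N) (λ j → if k ℕ.* j ≡ᵇ N then a k else 0#) ≈ lambertGF k N * a k
  divisor-indicator-sum a k zero = sym (zeroˡ (a k))
  divisor-indicator-sum a k (suc N) with k ∣? suc N
  ... | no k∤N = begin
    Σ R (range 1 (suc N)) f ≡⟨ foldr-range f 1 (suc N) ⟩
    sumFrom 1 (suc N) f     ≈⟨ sumFrom-zero 1 (suc N) (λ j _ _ → no-multiple j) ⟩
    0#                      ≈⟨ zeroˡ (a k) ⟨
    0# * a k                ∎
    where
    f : ℕ → A
    f j = if k ℕ.* j ≡ᵇ suc N then a k else 0#
    no-multiple : ∀ j → f j ≈ 0#
    no-multiple j = reflexive (≡.cong (λ b → if b then a k else 0#) (dec-false (k ℕ.* j ≟ suc N)
      (λ kj≡N → k∤N (divides j (≡.trans (≡.sym kj≡N) (ℕₚ.*-comm k j))))))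
  ... | yes (divides q N≡qk) = begin
    Σ R (range 1 (suc N)) f ≡⟨ foldr-range f 1 (suc N) ⟩
    sumFrom 1 (suc N) f     ≈⟨ sumFrom-unique 1 (suc N) q 1≤q (s≤s q≤N) other-j ⟩
    f q                     ≡⟨ ≡.cong (λ b → if b then a k else 0#) (dec-true (k ℕ.* q ≟ suc N) kq≡N) ⟩
    a k                     ≈⟨ *-identityˡ (a k) ⟨
    1# * a k                ∎
    where
    f : ℕ → A
    f j = if k ℕ.* j ≡ᵇ suc N then a k else 0#
    kq≡N : k ℕ.* q ≡ suc N
    kq≡N = ≡.trans (ℕₚ.*-comm k q) (≡.sym N≡qk)
    1≤q : 1 ≤ q
    1≤q = positive q N≡qk
      where
      positive : ∀ q → suc N ≡ q ℕ.* k → 1 ≤ q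
      positive (suc _) _ = s≤s z≤n
    q≤N : q ≤ suc N
    q≤N = ≤-trans (m≤m*n q k) (≤-reflexive (≡.sym N≡qk))
    other-j : ∀ j → j ≢ q → f j ≈ 0#
    other-j j j≢q = reflexive (≡.cong (λ b → if b then a k else 0#)
      (dec-false (k ℕ.* j ≟ suc N) (λ kj≡N → j≢q (ℕₚ.*-cancelˡ-≡ j q k (≡.trans kj≡N (≡.sym kq≡N))))))

  lambertLHS-lambertGF : ∀ a N → lambertLHS R a N ≈ sumFrom 1 N (λ k → lambertGF k N * a k)
  lambertLHS-lambertGF a N = begin
    lambertLHS R a N
      ≡⟨ foldr-range _ 1 N ⟩
    sumFrom 1 N (λ k → Σ R (range 1 N) (λ j → if k ℕ.* j ≡ᵇ N then a k else 0#))
      ≈⟨ sumFrom-cong 1 N (λ { (suc k) _ _ → divisor-indicator-sum a (suc k) N }) ⟩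
    sumFrom 1 N (λ k → lambertGF k N * a k)
      ∎

  lhs-split : ∀ a N → lambertLHS R a N ≈
    sumFrom 1 t (λ i → lambertGF i N * a i) + sumFrom (suc t) (suc N) (λ k → lambertGF k N * a k)
  lhs-split a N = begin
    lambertLHS R a N
      ≈⟨ lambertLHS-lambertGF a N ⟩
    sumFrom 1 N F
      ≈⟨ sumFrom-pad 1 N (t ℕ.+ suc N) F N≤t+1+N (λ k N<k → trans (*-cong (lambertGF-low k N<k) refl) (zeroˡ (a k))) ⟩
    sumFrom 1 (t ℕ.+ suc N) F
      ≈⟨ sumFrom-+ 1 t (suc N) F ⟩
    sumFrom 1 t F + sumFrom (suc t) (suc N) F
      ∎
    where
    F : ℕ → A
    F k = lambertGF k N * a k
    N≤t+1+N : N ≤ t ℕ.+ suc N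
    N≤t+1+N = ≤-trans (n≤1+n N) (m≤n+m (suc N) t)

  -- the factors of (q^(t+1); q)_∞ that matter up to degree N
  factors : ℕ → List ℕ
  factors N = range (suc t) (suc t ℕ.+ N)

  rhsSeries : (ℕ → A) → ℕ → PS R
  rhsSeries a N n = sumFrom 1 t (λ i → lambertPGF i n * a i)
                  + sumFrom (suc t) (suc N) (λ k → partsGF k (suc t ℕ.+ N) n * a k)

  rhsInner≐rhsSeries : ∀ a N → rhsInner R (suc t) a ≐[≤ N ] rhsSeries a N
  rhsInner≐rhsSeries a N zero    _ = sym (trans (+-cong lambertPGF-terms partsGF-terms) (+-identityʳ 0#))
    where
    lambertPGF-terms : sumFrom 1 t (λ i → lambertPGF i 0 * a i) ≈ 0#
    lambertPGF-terms = sumFrom-zero 1 t (λ { (suc i) _ _ → trans (*-cong (lambertPGF-low i (s≤s z≤n)) refl) (zeroˡ _) })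
    partsGF-terms : sumFrom (suc t) (suc N) (λ k → partsGF k (suc t ℕ.+ N) 0 * a k) ≈ 0#
    partsGF-terms = sumFrom-zero (suc t) (suc N) (λ k _ _ → zeroˡ (a k))
  rhsInner≐rhsSeries a N (suc n) 1+n≤N = +-cong lambertPGF-terms partsGF-terms
    where
    lambertPGF-terms : Σ R (range 1 t) (λ i → Σ R (range 1 (divFloor (suc n) i)) (λ j → pGF (suc n ∸ i ℕ.* j) * a i))
                       ≈ sumFrom 1 t (λ i → lambertPGF i (suc n) * a i)
    lambertPGF-terms = trans (reflexive (foldr-range _ 1 t))
      (sumFrom-cong 1 t (λ i _ _ → Σ-*ʳ (range 1 (divFloor (suc n) i)) (λ j → pGF (suc n ∸ i ℕ.* j)) (a i)))
    G : ℕ → A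
    G k = fromℕ R (s t (suc n) k) * a k
    no-part-beyond-n : ∀ k → suc t ℕ.+ (suc n ∸ t) ≤ k → G k ≈ 0#
    no-part-beyond-n k le = trans (*-cong (reflexive (≡.cong (fromℕ R) (partCount-small-bound (suc n)
      (≤-trans (s≤s (m≤n+m∸n (suc n) t)) le)))) refl) (zeroˡ (a k))
    1+n≤B : suc n ≤ suc t ℕ.+ N
    1+n≤B = ≤-trans 1+n≤N (m≤n+m N (suc t))
    partsGF-terms : Σ R (range (suc t) (suc n)) G ≈ sumFrom (suc t) (suc N) (λ k → partsGF k (suc t ℕ.+ N) (suc n) * a k)
    partsGF-terms = begin
      Σ R (range (suc t) (suc n)) G
        ≡⟨ foldr-range G (suc t) (suc n) ⟩
      sumFrom (suc t) (suc n ∸ t) G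
        ≈⟨ sumFrom-pad (suc t) (suc n ∸ t) (suc N) G (≤-trans (m∸n≤m (suc n) t) (m≤n⇒m≤1+n 1+n≤N)) no-part-beyond-n ⟩
      sumFrom (suc t) (suc N) G
        ≈⟨ sumFrom-cong (suc t) (suc N) (λ k _ _ →
             *-cong (reflexive (≡.cong (fromℕ R) (count-bound-irrelevant _ (suc n) ≤-refl 1+n≤B))) refl) ⟩
      sumFrom (suc t) (suc N) (λ k → partsGF k (suc t ℕ.+ N) (suc n) * a k)
        ∎

  rhs-split : ∀ a N → _⊛_ R (qPochInf R (suc t)) (rhsInner R (suc t) a) N ≈
    sumFrom 1 t (λ i → mulProd (factors N) (lambertPGF i) N * a i)
    + sumFrom (suc t) (suc N) (λ k → mulProd (factors N) (partsGF k (suc t ℕ.+ N)) N * a k)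
  rhs-split a N = begin
    _⊛_ R (qPochInf R (suc t)) (rhsInner R (suc t) a) N
      ≈⟨ ⊛-congˡ≤ N (rhsInner R (suc t) a) (qPochInf-truncation (suc t) N) N ≤-refl ⟩
    _⊛_ R (polyProd js) (rhsInner R (suc t) a) N
      ≈⟨ polyProd-⊛ js (rhsInner R (suc t) a) N ⟩
    mulProd js (rhsInner R (suc t) a) N
      ≈⟨ MulProd.cong≤ js N (rhsInner≐rhsSeries a N) N ≤-refl ⟩
    mulProd js (X ⊕ Y) N
      ≈⟨ MulProd.⊕-hom js X Y N ⟩
    mulProd js X N + mulProd js Y N
      ≈⟨ +-cong (MulProd.sum-hom js 1 t (λ i → lambertPGF i · a i) N)
                (MulProd.sum-hom js (suc t) (suc N) (λ k → partsGF k (suc t ℕ.+ N) · a k) N) ⟩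
    sumFrom 1 t (λ i → mulProd js (lambertPGF i · a i) N)
    + sumFrom (suc t) (suc N) (λ k → mulProd js (partsGF k (suc t ℕ.+ N) · a k) N)
      ≈⟨ +-cong (sumFrom-cong 1 t (λ i _ _ → MulProd.·-hom js (lambertPGF i) (a i) N))
                (sumFrom-cong (suc t) (suc N) (λ k _ _ → MulProd.·-hom js (partsGF k (suc t ℕ.+ N)) (a k) N)) ⟩
    sumFrom 1 t (λ i → mulProd js (lambertPGF i) N * a i)
    + sumFrom (suc t) (suc N) (λ k → mulProd js (partsGF k (suc t ℕ.+ N)) N * a k)
      ∎
    where
    js : List ℕ
    js = factors N
    X : PS R
    X n = sumFrom 1 t (λ i → lambertPGF i n * a i)
    Y : PS R
    Y n = sumFrom (suc t) (suc N) (λ k → partsGF k (suc t ℕ.+ N) n * a k)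

mainTheorem2 : {c ℓ : Level} (R : CommutativeRing c ℓ) (m : ℕ) → 1 ≤ m →
    (a : ℕ → CommutativeRing.Carrier R) → (N : ℕ) →
    CommutativeRing._≈_ R (lambertLHS R a N)
    (_⊛_ R (qPochInf R m) (rhsInner R m a) N)
mainTheorem2 R (suc t) (s≤s z≤n) a N = begin
  lambertLHS R a N
    ≈⟨ lhs-split a N ⟩
  sumFrom 1 t (λ i → lambertGF i N * a i) + sumFrom (suc t) (suc N) (λ k → lambertGF k N * a k)
    ≈⟨ +-cong (sumFrom-cong 1 t (λ { (suc i) _ _ → *-cong (mulProd-lambertPGF i t≤B N N≤B) refl }))
              (sumFrom-cong (suc t) (suc N) (λ k t<k k<1+B → *-cong (mulProd-partsGF t<k (k≤B k<1+B) N) refl)) ⟨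
  sumFrom 1 t (λ i → mulProd (factors N) (lambertPGF i) N * a i)
  + sumFrom (suc t) (suc N) (λ k → mulProd (factors N) (partsGF k B) N * a k)
    ≈⟨ rhs-split a N ⟨
  _⊛_ R (qPochInf R (suc t)) (rhsInner R (suc t) a) N
    ∎
  where
  open CommutativeRing R
  open PowerSeries R using (mulProd)
  open PartitionSeries R t
  open IntervalSum +-commutativeMonoid using (sumFrom; sumFrom-cong)
  open import Relation.Binary.Reasoning.Setoid setoid
  B : ℕ
  B = suc t ℕ.+ N
  t≤B : t ≤ B
  t≤B = m≤n⇒m≤1+n (m≤m+n t N)
  N≤B : N ≤ B
  N≤B = m≤n+m N (suc t)
  k≤B : ∀ {k} → k < suc t ℕ.+ suc N → k ≤ B
  k≤B k< = ≤-pred (≤-trans k< (≤-reflexive (ℕₚ.+-suc (suc t) N)))
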